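{- For every connected graph $G$ of order $n$, $\chi_{\mu_2}(G)\le \lceil n/2\rceil$. Moreover, this bound is sharp: there are infinitely many connected graphs $G$ with $\chi_{\mu_2}(G)=\lceil |V(G)|/2\rceil$.
   Context: All graphs are finite, simple and undirected. A $u,v$-geodesic is a shortest $u,v$-path. A set $M\subseteq V(G)$ is a $2$-distance mutual-visibility set if for every two distinct $u,v\in M$ there is a $u,v$-geodesic of length at most $2$ none of whose internal vertices lies in $M$. $\chi_{\mu_2}(G)$ is the minimum number of parts in a partition of $V(G)$ into $2$-distance mutual-visibility sets. -}

module Defs where

open import Data.Nat using (ℕ; zero; suc; _≤_; _<_)
open import Data.Fin using (Fin)
open import Data.Bool using (Bool; true; false)
open import Data.List using (List; []; _∷_)
open import Data.List.Membership.Propositional using (_∈_)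
open import Data.Product using (Σ; ∃; _×_; _,_)
open import Relation.Binary.PropositionalEquality using (_≡_)
open import Relation.Nullary using (¬_)

record Graph (n : ℕ) : Set where
  field
    adj   : Fin n → Fin n → Bool
    sym   : ∀ u v → adj u v ≡ adj v u
    irrefl : ∀ v → adj v v ≡ false

module _ {n : ℕ} (G : Graph n) where
  open Graph G

  Adj : Fin n → Fin n → Set
  Adj u v = adj u v ≡ true

  data Walk : Fin n → Fin n → Set where
    []  : ∀ {v} → Walk v v
    _∷_ : ∀ {u w v} → Adj u w → Walk w v → Walk u v

  length : ∀ {u v} → Walk u v → ℕ
  length []      = zero
  length (_ ∷ p) = suc (length p)

  internal : ∀ {u v} → Walk u v → List (Fin n)
  internal []                = []
  internal (_ ∷ [])          = []
  internal (_∷_ {w = w} _ p@(_ ∷ _)) = w ∷ internal p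

  IsGeodesic : ∀ {u v} → Walk u v → Set
  IsGeodesic {u} {v} p = ∀ (q : Walk u v) → length p ≤ length q

  Connected : Set
  Connected = ∀ u v → Walk u v

  IsTwoDistMVSet : (Fin n → Set) → Set
  IsTwoDistMVSet M =
    ∀ u v → M u → M v → ¬ (u ≡ v) →
      Σ (Walk u v) λ p →
        IsGeodesic p × length p ≤ 2 × (∀ x → x ∈ internal p → ¬ M x)

  -- a partition of V(G) into at most k 2-distance mutual-visibility sets,
  -- given by the class map c : V(G) → Fin k (classes c⁻¹(i))
  HasTwoDistMVPartition : ℕ → Set
  HasTwoDistMVPartition k =
    Σ (Fin n → Fin k) λ c → ∀ (i : Fin k) → IsTwoDistMVSet (λ x → c x ≡ i)

  χμ₂≡ : ℕ → Set
  χμ₂≡ k = HasTwoDistMVPartition k × (∀ j → j < k → ¬ HasTwoDistMVPartition j)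

{-# OPTIONS --safe #-}
-- Upper bound: a colour class is a 2-distance mutual-visibility set as soon as any two of
-- its vertices are adjacent or have a common neighbour of another colour. Take breadth-first
-- levels from a root, a deepest vertex x and its parent p. If p has another child y at the
-- depth of x, then x and y see each other through p; otherwise x and p are adjacent. Either
-- way every remaining vertex keeps a neighbour one level lower, so the rest stays connected,
-- and giving the removed pair a fresh colour yields ⌈n/2⌉ colours by induction. The minimum
-- exists because partitions into k classes can be searched exhaustively.
--
-- Sharpness: in the path two vertices at distance two see each other only through the vertex
-- between them, so no colour class has three vertices.
module Submission where

open import Defs
open import Data.Nat using (ℕ; _≤_; ⌈_/2⌉)
open import Data.Product using (Σ; _×_)

open import Data.Bool using (Bool; true; false; _∨_)
open import Data.Bool.Properties using (∨-comm; T-≡; T-∨) renaming (_≟_ to _≟ᵇ_)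
open import Data.Empty using (⊥)
open import Data.Fin using (Fin; zero; suc; toℕ; fromℕ<; combine)
open import Data.Fin.Properties
  using (any?; all?; toℕ-injective; toℕ-fromℕ<; combine-injective; injective⇒≤)
  renaming (_≟_ to _≟ᶠ_)
open import Data.Fin.Subset using (Subset; inside; outside; _∈_; _∉_; _-_; ∣_∣; Nonempty; ⊤)
open import Data.Fin.Subset.Properties
  using (_∈?_; ∈⊤; nonempty?; Empty-unique; ∣⊥∣≡0; ∣⊤∣≡n; p─⊥≡p; p─q⊆p; x∈p∧x≢y⇒x∈p-y)
open import Data.List using (List; filter; allFin)
open import Data.List.Membership.Propositional using () renaming (_∈_ to _∈ₗ_)
open import Data.List.Membership.Propositional.Properties using (∈-filter⁺; ∈-allFin)
import Data.List.Relation.Unary.All as All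
open import Data.List.Relation.Unary.All.Properties using (all-filter)
import Data.List.Relation.Unary.Any as Any
open import Data.Nat using (zero; suc; _+_; _<_; _*_; _≡ᵇ_; z≤n; s≤s)
open import Data.Nat.Properties
  using (≤-totalOrder; ≤-refl; ≤-trans; ≤-antisym; ≤-reflexive; ≤-pred; ≤-<-trans; <-irrefl;
         <-trans; <-cmp; <⇒≱; ≮⇒≥; _<?_; m≤n+m; n<1+n; m<1+n⇒m<n∨m≡n; 0≢1+n; 1+n≢0; 1+n≰n;
         suc-injective; ≡ᵇ⇒≡)
  renaming (_≟_ to _≟ⁿ_)
open import Data.List.Extrema ≤-totalOrder using (argmax; argmax-all; f[xs]≤f[argmax])
open import Data.Product using (∃; _,_; proj₁; proj₂)
open import Data.Sum using (_⊎_; inj₁; inj₂; [_,_]′)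
import Data.Sum as Sum
open import Data.Vec using (_∷_; here; there)
import Data.Vec.Functional as Vector
open import Function using (id; _∘_)
open import Function.Bundles using (Equivalence; _⇔_; mk⇔)
open import Function.Definitions using (Injective)
open import Relation.Binary using (DecidableEquality; tri<; tri≈; tri>)
open import Relation.Binary.PropositionalEquality
  using (_≡_; _≢_; _≗_; refl; sym; trans; cong; subst; ≢-sym)
open import Relation.Nullary using (¬_; Dec; yes; no; contradiction)
open import Relation.Nullary.Decidable using (map′; ¬?; _×-dec_; _⊎-dec_; _→-dec_)
open import Relation.Unary using (Decidable)

x∈p⇒∣p∣≡suc∣p-x∣ : ∀ {n} {p : Subset n} {x} → x ∈ p → ∣ p ∣ ≡ suc ∣ p - x ∣
x∈p⇒∣p∣≡suc∣p-x∣ {p = inside  ∷ p} here        = cong suc (cong ∣_∣ (sym (p─⊥≡p p)))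
x∈p⇒∣p∣≡suc∣p-x∣ {p = inside  ∷ p} (there x∈p) = cong suc (x∈p⇒∣p∣≡suc∣p-x∣ x∈p)
x∈p⇒∣p∣≡suc∣p-x∣ {p = outside ∷ p} (there x∈p) = x∈p⇒∣p∣≡suc∣p-x∣ x∈p

x∈p⇒∣p∣≢0 : ∀ {n} {p : Subset n} {x} → x ∈ p → ∣ p ∣ ≢ 0
x∈p⇒∣p∣≢0 x∈p ∣p∣≡0 = 1+n≢0 (trans (sym (x∈p⇒∣p∣≡suc∣p-x∣ x∈p)) ∣p∣≡0)

x∉p-x : ∀ {n} {p : Subset n} x → x ∉ p - x
x∉p-x {p = _ ∷ _} zero    ()
x∉p-x {p = _ ∷ _} (suc x) (there x∈p-x) = x∉p-x x x∈p-x

x∈p-y⇒x∈p×x≢y : ∀ {n} {p : Subset n} {x y} → x ∈ p - y → x ∈ p × x ≢ y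
x∈p-y⇒x∈p×x≢y {p = p} {y = y} x∈p-y = p─q⊆p p _ x∈p-y , λ { refl → x∉p-x y x∈p-y }

x∈p-y-z⇒x∈p×x≢y×x≢z : ∀ {n} {p : Subset n} {x y z} → x ∈ p - y - z → x ∈ p × x ≢ y × x ≢ z
x∈p-y-z⇒x∈p×x≢y×x≢z x∈p-y-z =
  let (x∈p-y , x≢z) = x∈p-y⇒x∈p×x≢y x∈p-y-z
      (x∈p , x≢y)   = x∈p-y⇒x∈p×x≢y x∈p-y
  in x∈p , x≢y , x≢z

x∈p∧x≢y∧x≢z⇒x∈p-y-z : ∀ {n} {p : Subset n} {x y z} → x ∈ p → x ≢ y → x ≢ z → x ∈ p - y - z
x∈p∧x≢y∧x≢z⇒x∈p-y-z x∈p x≢y x≢z = x∈p∧x≢y⇒x∈p-y (x∈p∧x≢y⇒x∈p-y x∈p x≢y) x≢z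

∣p∣≡2+∣p-x-y∣ : ∀ {n} {p : Subset n} {x y} → x ∈ p → y ∈ p - x → ∣ p ∣ ≡ 2 + ∣ p - x - y ∣
∣p∣≡2+∣p-x-y∣ x∈p y∈p-x = trans (x∈p⇒∣p∣≡suc∣p-x∣ x∈p) (cong suc (x∈p⇒∣p∣≡suc∣p-x∣ y∈p-x))

∣p∣≡1⇒x≡y : ∀ {n} {p : Subset n} {x y} → ∣ p ∣ ≡ 1 → x ∈ p → y ∈ p → x ≡ y
∣p∣≡1⇒x≡y {x = x} {y} ∣p∣≡1 x∈p y∈p with x ≟ᶠ y
... | yes x≡y = x≡y
... | no x≢y  = contradiction (suc-injective (trans (sym (x∈p⇒∣p∣≡suc∣p-x∣ x∈p)) ∣p∣≡1))
                              (x∈p⇒∣p∣≢0 (x∈p∧x≢y⇒x∈p-y y∈p (≢-sym x≢y)))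

∣p∣≡suc⇒Nonempty : ∀ {n k} {p : Subset n} → ∣ p ∣ ≡ suc k → Nonempty p
∣p∣≡suc⇒Nonempty {n} {p = p} ∣p∣≡1+k with nonempty? p
... | yes nonempty = nonempty
... | no empty     =
  contradiction (trans (sym ∣p∣≡1+k) (trans (cong ∣_∣ (Empty-unique empty)) (∣⊥∣≡0 n))) 1+n≢0

argmax-on : ∀ {n} (f : Fin n → ℕ) {S : Subset n} → Nonempty S →
            Σ (Fin n) λ x → x ∈ S × (∀ {y} → y ∈ S → f y ≤ f x)
argmax-on {n} f {S} (t , t∈S) =
  argmax f t xs , argmax-all f t∈S (all-filter (_∈? S) (allFin n)) ,
  λ y∈S → All.lookup (f[xs]≤f[argmax] t xs) (∈-filter⁺ (_∈? S) (∈-allFin _) y∈S)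
  where
  xs : List (Fin n)
  xs = filter (_∈? S) (allFin n)

-- Least witnesses and exhaustive search

Least : (ℕ → Set) → ℕ → Set
Least P k = P k × (∀ j → j < k → ¬ P j)

least-below : ∀ {P : ℕ → Set} → Decidable P → ∀ m → Σ ℕ (Least P) ⊎ (∀ j → j < m → ¬ P j)
least-below P? zero = inj₂ λ _ ()
least-below P? (suc m) with least-below P? m
... | inj₁ found = inj₁ found
... | inj₂ none with P? m
...   | yes pm = inj₁ (m , pm , none)
...   | no ¬pm = inj₂ λ j j<1+m → [ none j , (λ { refl → ¬pm }) ]′ (m<1+n⇒m<n∨m≡n j<1+m)

least : ∀ {P : ℕ → Set} → Decidable P → ∀ {m} → P m → Σ ℕ (Least P)
least P? {m} pm = [ id , (λ none → contradiction pm (none m (n<1+n m))) ]′ (least-below P? (suc m))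

Least⇒≤ : ∀ {P : ℕ → Set} {k m} → Least P k → P m → k ≤ m
Least⇒≤ (_ , below) pm = ≮⇒≥ λ m<k → below _ m<k pm

-- Without function extensionality, P has to respect pointwise equality.
any-function? : ∀ n {k} {P : (Fin n → Fin k) → Set} →
                (∀ {c d} → c ≗ d → P c → P d) → (∀ c → Dec (P c)) → Dec (∃ P)
any-function? zero resp P? = map′ (Vector.[] ,_) (λ (c , p) → resp (λ ()) p) (P? Vector.[])
any-function? (suc n) resp P? =
  map′ (λ (a , c , p) → a Vector.∷ c , p)
       (λ (c , p) → Vector.head c , Vector.tail c , resp (λ { zero → refl ; (suc _) → refl }) p)
       (any? λ a → any-function? n (λ c≗d → resp λ { zero → refl ; (suc i) → c≗d i })
                                   (λ c → P? (a Vector.∷ c)))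

-- Colourings whose classes are 2-distance mutual-visibility sets

module _ {n : ℕ} (G : Graph n) where

  adj? : ∀ u v → Dec (Adj G u v)
  adj? u v = Graph.adj G u v ≟ᵇ true

  Adj-sym : ∀ {u v} → Adj G u v → Adj G v u
  Adj-sym {u} {v} uv = trans (Graph.sym G v u) uv

  Adj⇒≢ : ∀ {u v} → Adj G u v → u ≢ v
  Adj⇒≢ {u} uu refl = contradiction (trans (sym (Graph.irrefl G u)) uu) λ ()

  length≥1 : ∀ {u v} → u ≢ v → (q : Walk G u v) → 1 ≤ length G q
  length≥1 u≢v []      = contradiction refl u≢v
  length≥1 u≢v (_ ∷ _) = s≤s z≤n

  length≥2 : ∀ {u v} → u ≢ v → ¬ Adj G u v → (q : Walk G u v) → 2 ≤ length G q
  length≥2 u≢v _   []            = contradiction refl u≢v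
  length≥2 _   ¬uv (uv ∷ [])     = contradiction uv ¬uv
  length≥2 _   _   (_ ∷ _ ∷ _)   = s≤s (s≤s z≤n)

  -- A path u w v between non-adjacent vertices is a geodesic, so for distinct u, v of the same
  -- colour this is exactly what the colour class needs (colouring⇒partition, partition⇒colouring).
  Visible : ∀ {A : Set} → (Fin n → A) → Fin n → Fin n → Set
  Visible c u v = Adj G u v ⊎ Σ (Fin n) λ w → Adj G u w × Adj G w v × c w ≢ c u

  IsMVColouringOn : ∀ {A : Set} → Subset n → (Fin n → A) → Set
  IsMVColouringOn S c = ∀ u v → u ∈ S → v ∈ S → u ≢ v → c u ≡ c v → Visible c u v

  Visible-sym : ∀ {A} {c : Fin n → A} {u v} → c u ≡ c v → Visible c u v → Visible c v u
  Visible-sym _     (inj₁ uv)                    = inj₁ (Adj-sym uv)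
  Visible-sym cu≡cv (inj₂ (w , uw , wv , cw≢cu)) =
    inj₂ (w , Adj-sym wv , Adj-sym uw , λ cw≡cv → cw≢cu (trans cw≡cv (sym cu≡cv)))

  IsMVColouringOn-map : ∀ {A B} {S} {c : Fin n → A} {d : Fin n → B} (f : A → B) →
                        (∀ x → f (c x) ≡ d x) → IsMVColouringOn S d → IsMVColouringOn S c
  IsMVColouringOn-map {c = c} {d} f fc≗d good u v u∈S v∈S u≢v cu≡cv =
    Sum.map₂ (λ (w , uw , wv , dw≢du) → w , uw , wv , dw≢du ∘ resp)
             (good u v u∈S v∈S u≢v (resp cu≡cv))
    where
    resp : ∀ {x y} → c x ≡ c y → d x ≡ d y
    resp {x} {y} cx≡cy = trans (sym (fc≗d x)) (trans (cong f cx≡cy) (fc≗d y))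

  visible? : ∀ {A} → DecidableEquality A → (c : Fin n → A) → ∀ u v → Dec (Visible c u v)
  visible? _≟_ c u v = adj? u v ⊎-dec any? λ w → adj? u w ×-dec adj? w v ×-dec ¬? (c w ≟ c u)

  isMVColouringOn? : ∀ {A} → DecidableEquality A → ∀ S (c : Fin n → A) → Dec (IsMVColouringOn S c)
  isMVColouringOn? _≟_ S c = all? λ u → all? λ v →
    u ∈? S →-dec v ∈? S →-dec ¬? (u ≟ᶠ v) →-dec c u ≟ c v →-dec visible? _≟_ c u v

  colouring⇒partition : ∀ {k} (c : Fin n → Fin k) → IsMVColouringOn ⊤ c → HasTwoDistMVPartition G k
  colouring⇒partition c good = c , λ { _ u v refl cv≡cu u≢v → short-walk u v u≢v (sym cv≡cu) }
    where
    short-walk : ∀ u v → u ≢ v → c u ≡ c v →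
                 Σ (Walk G u v) λ p → IsGeodesic G p × length G p ≤ 2 ×
                                      (∀ x → x ∈ₗ internal G p → c x ≢ c u)
    short-walk u v u≢v cu≡cv with adj? u v | good u v ∈⊤ ∈⊤ u≢v cu≡cv
    ... | yes uv | _        = uv ∷ [] , length≥1 u≢v , s≤s z≤n , λ _ ()
    ... | no ¬uv | inj₁ uv  = contradiction uv ¬uv
    ... | no ¬uv | inj₂ (w , uw , wv , cw≢cu) =
      uw ∷ wv ∷ [] , length≥2 u≢v ¬uv , ≤-refl ,
      λ { _ (Any.here refl) → cw≢cu ; _ (Any.there ()) }

  partition⇒colouring : ∀ {k} → HasTwoDistMVPartition G k → Σ (Fin n → Fin k) (IsMVColouringOn ⊤)
  partition⇒colouring (c , mv) =
    c , λ u v _ _ u≢v cu≡cv → short-walk⇒Visible u≢v (mv (c u) u v refl (sym cu≡cv) u≢v)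
    where
    short-walk⇒Visible : ∀ {u v} → u ≢ v →
      Σ (Walk G u v) (λ p → IsGeodesic G p × length G p ≤ 2 ×
                            (∀ x → x ∈ₗ internal G p → c x ≢ c u)) →
      Visible c u v
    short-walk⇒Visible u≢v ([] , _)                             = contradiction refl u≢v
    short-walk⇒Visible _   (uv ∷ [] , _)                        = inj₁ uv
    short-walk⇒Visible _   (uw ∷ wv ∷ [] , _ , _ , c-internal≢) =
      inj₂ (_ , uw , wv , c-internal≢ _ (Any.here refl))
    short-walk⇒Visible _   (_ ∷ _ ∷ _ ∷ _ , _ , s≤s (s≤s ()) , _)

  hasTwoDistMVPartition? : ∀ k → Dec (HasTwoDistMVPartition G k)
  hasTwoDistMVPartition? k =
    map′ (λ (c , good) → colouring⇒partition c good) partition⇒colouring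
         (any-function? n (λ c≗d → IsMVColouringOn-map id (sym ∘ c≗d)) (isMVColouringOn? _≟ᶠ_ ⊤))

  VisiblePair : Fin n → Fin n → Set
  VisiblePair a b = Adj G a b ⊎ Σ (Fin n) λ w → Adj G a w × Adj G w b × w ≢ a × w ≢ b

  -- Nothing is required of the root itself: it lies in S as soon as S is nonempty (root∈),
  -- and deleting it from S still leaves a layering.
  record Layering (S : Subset n) : Set where
    field
      root   : Fin n
      level  : Fin n → ℕ
      parent : ∀ {v} → v ∈ S → v ≢ root →
               Σ (Fin n) λ w → w ∈ S × Adj G v w × level v ≡ suc (level w)

  record RemovablePair (S : Subset n) : Set where
    field
      a b      : Fin n
      a∈S      : a ∈ S
      b∈S-a    : b ∈ S - a
      visible  : VisiblePair a b
      layering : Layering (S - a - b)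

  module _ {S : Subset n} (L : Layering S) where
    open Layering L

    root∈ : Nonempty S → root ∈ S
    root∈ (v , v∈S) = descend (suc (level v)) v∈S (n<1+n (level v))
      where
      descend : ∀ ℓ {v} → v ∈ S → level v < ℓ → root ∈ S
      descend (suc ℓ) {v} v∈S lv<1+ℓ with v ≟ᶠ root
      ... | yes refl = v∈S
      ... | no v≢root with parent v∈S v≢root
      ...   | w , w∈S , _ , lv≡1+lw = descend ℓ w∈S (subst (_≤ ℓ) lv≡1+lw (≤-pred lv<1+ℓ))

    Layering-remove : ∀ {a b} →
      (∀ {v w} → v ∈ S - a - b → v ≢ root → Adj G v w → level v ≡ suc (level w) → w ≢ a × w ≢ b) →
      Layering (S - a - b)
    Layering-remove {a} {b} avoids = record { root = root ; level = level ; parent = parent′ }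
      where
      parent′ : ∀ {v} → v ∈ S - a - b → v ≢ root →
                Σ (Fin n) λ w → w ∈ S - a - b × Adj G v w × level v ≡ suc (level w)
      parent′ v∈S′ v≢root with parent (proj₁ (x∈p-y-z⇒x∈p×x≢y×x≢z v∈S′)) v≢root
      ... | w , w∈S , vw , lv≡1+lw with avoids v∈S′ v≢root vw lv≡1+lw
      ...   | w≢a , w≢b = w , x∈p∧x≢y∧x≢z⇒x∈p-y-z w∈S w≢a w≢b , vw , lv≡1+lw

    deepest-non-root : ∀ {s} → ∣ S ∣ ≡ 2 + s →
                       Σ (Fin n) λ x → x ∈ S - root × (∀ {y} → y ∈ S - root → level y ≤ level x)
    deepest-non-root {s} ∣S∣≡2+s = argmax-on level (∣p∣≡suc⇒Nonempty ∣S-root∣≡1+s)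
      where
      ∣S-root∣≡1+s : ∣ S - root ∣ ≡ suc s
      ∣S-root∣≡1+s = suc-injective
        (trans (sym (x∈p⇒∣p∣≡suc∣p-x∣ (root∈ (∣p∣≡suc⇒Nonempty ∣S∣≡2+s)))) ∣S∣≡2+s)

    module _ {x} (x∈S : x ∈ S) (x≢root : x ≢ root)
             (deepest : ∀ {y} → y ∈ S - root → level y ≤ level x) where

      shallower : ∀ {v w} → v ∈ S → v ≢ root → level v ≡ suc (level w) → level w ≢ level x
      shallower v∈S v≢root lv≡1+lw lw≡lx =
        1+n≰n (subst (_≤ level x) (trans lv≡1+lw (cong suc lw≡lx))
                     (deepest (x∈p∧x≢y⇒x∈p-y v∈S v≢root)))

      Sibling : Fin n → Set
      Sibling p = Σ (Fin n) λ y → y ∈ S × y ≢ x × Adj G p y × level y ≡ level x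

      sibling? : ∀ p → Dec (Sibling p)
      sibling? p = any? λ y → y ∈? S ×-dec ¬? (y ≟ᶠ x) ×-dec adj? p y ×-dec level y ≟ⁿ level x

      remove-siblings : ∀ {p} → Adj G x p → Sibling p → RemovablePair S
      remove-siblings {p} xp (y , y∈S , y≢x , py , ly≡lx) = record
        { a = x ; b = y ; a∈S = x∈S ; b∈S-a = x∈p∧x≢y⇒x∈p-y y∈S y≢x
        ; visible  = inj₂ (p , xp , py , ≢-sym (Adj⇒≢ xp) , Adj⇒≢ py)
        ; layering = Layering-remove λ v∈S′ v≢root _ lv≡1+lw →
            let v∈S = proj₁ (x∈p-y-z⇒x∈p×x≢y×x≢z v∈S′) in
            (λ { refl → shallower v∈S v≢root lv≡1+lw refl }) ,
            (λ { refl → shallower v∈S v≢root lv≡1+lw ly≡lx })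
        }

      remove-with-parent : ∀ {p} → p ∈ S → Adj G x p → level x ≡ suc (level p) → ¬ Sibling p →
                           RemovablePair S
      remove-with-parent {p} p∈S xp lx≡1+lp no-sibling = record
        { a = x ; b = p ; a∈S = x∈S ; b∈S-a = x∈p∧x≢y⇒x∈p-y p∈S (≢-sym (Adj⇒≢ xp))
        ; visible  = inj₁ xp
        ; layering = Layering-remove λ {v} v∈S′ v≢root vw lv≡1+lw →
            let (v∈S , v≢x , _) = x∈p-y-z⇒x∈p×x≢y×x≢z v∈S′ in
            (λ { refl → shallower v∈S v≢root lv≡1+lw refl }) ,
            (λ { refl → no-sibling (v , v∈S , v≢x , Adj-sym vw , trans lv≡1+lw (sym lx≡1+lp)) })
        }

      removable-pair-at : RemovablePair S
      removable-pair-at with parent x∈S x≢root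
      ... | p , p∈S , xp , lx≡1+lp with sibling? p
      ...   | yes sibling   = remove-siblings xp sibling
      ...   | no no-sibling = remove-with-parent p∈S xp lx≡1+lp no-sibling

    removable-pair : ∀ {s} → ∣ S ∣ ≡ 2 + s → RemovablePair S
    removable-pair ∣S∣≡2+s =
      let (x , x∈S-root , deepest) = deepest-non-root ∣S∣≡2+s
          (x∈S , x≢root)           = x∈p-y⇒x∈p×x≢y x∈S-root
      in removable-pair-at x∈S x≢root deepest

  -- Colours are naturals bounded only on S, since the vertices outside S need a colour too.
  MVColouringOn : Subset n → ℕ → Set
  MVColouringOn S k = Σ (Fin n → ℕ) λ c → IsMVColouringOn S c × (∀ {v} → v ∈ S → c v < k)

  module Extend (a b : Fin n) (c : Fin n → ℕ) where

    Kept : Fin n → Set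
    Kept v = v ≢ a × v ≢ b

    removed-or-kept : ∀ v → (v ≡ a ⊎ v ≡ b) ⊎ Kept v
    removed-or-kept v with v ≟ᶠ a | v ≟ᶠ b
    ... | yes v≡a | _       = inj₁ (inj₁ v≡a)
    ... | no _    | yes v≡b = inj₁ (inj₂ v≡b)
    ... | no v≢a  | no v≢b  = inj₂ (v≢a , v≢b)

    extended : Fin n → ℕ
    extended v with removed-or-kept v
    ... | inj₁ _ = 0
    ... | inj₂ _ = suc (c v)

    extended-removed : ∀ {v} → v ≡ a ⊎ v ≡ b → extended v ≡ 0
    extended-removed {v} removed with removed-or-kept v
    ... | inj₁ _             = refl
    ... | inj₂ (v≢a , v≢b) = contradiction removed [ v≢a , v≢b ]′

    extended-kept : ∀ {v} → Kept v → extended v ≡ suc (c v)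
    extended-kept {v} (v≢a , v≢b) with removed-or-kept v
    ... | inj₁ removed = contradiction removed [ v≢a , v≢b ]′
    ... | inj₂ _       = refl

    extended-separates : ∀ {u w} → Kept u → c w ≢ c u → extended w ≢ extended u
    extended-separates {u} {w} ku cw≢cu ew≡eu = [ removed , kept ]′ (removed-or-kept w)
      where
      removed : w ≡ a ⊎ w ≡ b → ⊥
      removed rw = 0≢1+n (trans (sym (extended-removed rw)) (trans ew≡eu (extended-kept ku)))
      kept : Kept w → ⊥
      kept kw = cw≢cu (suc-injective (trans (sym (extended-kept kw)) (trans ew≡eu (extended-kept ku))))

    visible-pair : VisiblePair a b → Visible extended a b
    visible-pair (inj₁ ab) = inj₁ ab
    visible-pair (inj₂ (w , aw , wb , w≢a , w≢b)) =
      inj₂ (w , aw , wb , λ ew≡ea →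
        1+n≢0 (trans (sym (extended-kept (w≢a , w≢b))) (trans ew≡ea (extended-removed (inj₁ refl)))))

    visible-removed : VisiblePair a b → ∀ {u v} → u ≡ a ⊎ u ≡ b → v ≡ a ⊎ v ≡ b → u ≢ v →
                      Visible extended u v
    visible-removed _  (inj₁ refl) (inj₁ refl) u≢v = contradiction refl u≢v
    visible-removed ab (inj₁ refl) (inj₂ refl) _   = visible-pair ab
    visible-removed ab (inj₂ refl) (inj₁ refl) _   =
      Visible-sym (trans (extended-removed (inj₁ refl)) (sym (extended-removed (inj₂ refl))))
                  (visible-pair ab)
    visible-removed _  (inj₂ refl) (inj₂ refl) u≢v = contradiction refl u≢v

    extended-good : ∀ {S} → IsMVColouringOn (S - a - b) c → VisiblePair a b →
                    IsMVColouringOn S extended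
    extended-good good ab u v u∈S v∈S u≢v eu≡ev = by-cases (removed-or-kept u) (removed-or-kept v)
      where
      by-cases : (u ≡ a ⊎ u ≡ b) ⊎ Kept u → (v ≡ a ⊎ v ≡ b) ⊎ Kept v → Visible extended u v
      by-cases (inj₁ ru) (inj₁ rv) = visible-removed ab ru rv u≢v
      by-cases (inj₁ ru) (inj₂ kv) =
        contradiction (trans (sym (extended-removed ru)) (trans eu≡ev (extended-kept kv))) 0≢1+n
      by-cases (inj₂ ku) (inj₁ rv) =
        contradiction (trans (sym (extended-kept ku)) (trans eu≡ev (extended-removed rv))) 1+n≢0
      by-cases (inj₂ ku@(u≢a , u≢b)) (inj₂ kv@(v≢a , v≢b)) =
        Sum.map₂ (λ (w , uw , wv , cw≢cu) → w , uw , wv , extended-separates ku cw≢cu)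
          (good u v (x∈p∧x≢y∧x≢z⇒x∈p-y-z u∈S u≢a u≢b) (x∈p∧x≢y∧x≢z⇒x∈p-y-z v∈S v≢a v≢b) u≢v
                (suc-injective (trans (sym (extended-kept ku)) (trans eu≡ev (extended-kept kv)))))

    extended-bound : ∀ {S k} → (∀ {v} → v ∈ S - a - b → c v < k) →
                     ∀ {v} → v ∈ S → extended v < suc k
    extended-bound {k = k} bound {v} v∈S = [ removed , kept ]′ (removed-or-kept v)
      where
      removed : v ≡ a ⊎ v ≡ b → extended v < suc k
      removed rv = subst (_< suc _) (sym (extended-removed rv)) (s≤s z≤n)
      kept : Kept v → extended v < suc k
      kept kv@(v≢a , v≢b) =
        subst (_< suc _) (sym (extended-kept kv)) (s≤s (bound (x∈p∧x≢y∧x≢z⇒x∈p-y-z v∈S v≢a v≢b)))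

  pair-colouring : ∀ s {S} → ∣ S ∣ ≡ s → (Nonempty S → Layering S) → MVColouringOn S ⌈ s /2⌉
  pair-colouring zero ∣S∣≡0 _ =
    (λ _ → 0) , (λ u _ u∈S _ _ _ → contradiction ∣S∣≡0 (x∈p⇒∣p∣≢0 u∈S)) ,
    λ v∈S → contradiction ∣S∣≡0 (x∈p⇒∣p∣≢0 v∈S)
  pair-colouring 1 ∣S∣≡1 _ =
    (λ _ → 0) , (λ u v u∈S v∈S u≢v _ → contradiction (∣p∣≡1⇒x≡y ∣S∣≡1 u∈S v∈S) u≢v) , λ _ → s≤s z≤n
  pair-colouring (suc (suc s)) {S} ∣S∣≡2+s layering-of =
    let open RemovablePair (removable-pair (layering-of (∣p∣≡suc⇒Nonempty ∣S∣≡2+s)) ∣S∣≡2+s)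
        ∣S-a-b∣≡s : ∣ S - a - b ∣ ≡ s
        ∣S-a-b∣≡s = suc-injective (suc-injective (trans (sym (∣p∣≡2+∣p-x-y∣ a∈S b∈S-a)) ∣S∣≡2+s))
        (c , good , bound) = pair-colouring s ∣S-a-b∣≡s (λ _ → layering)
        open Extend a b c
    in extended , extended-good good visible , extended-bound bound

  module _ (connected : Connected G) (r : Fin n) where

    WithinDistance : ℕ → Fin n → Set
    WithinDistance zero    v = v ≡ r
    WithinDistance (suc k) v = v ≡ r ⊎ Σ (Fin n) λ w → Adj G v w × WithinDistance k w

    withinDistance? : ∀ k v → Dec (WithinDistance k v)
    withinDistance? zero    v = v ≟ᶠ r
    withinDistance? (suc k) v = v ≟ᶠ r ⊎-dec any? λ w → adj? v w ×-dec withinDistance? k w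

    walk⇒WithinDistance : ∀ {v} (q : Walk G v r) → WithinDistance (length G q) v
    walk⇒WithinDistance []       = refl
    walk⇒WithinDistance (vw ∷ q) = inj₂ (_ , vw , walk⇒WithinDistance q)

    distance : ∀ v → Σ ℕ (Least λ k → WithinDistance k v)
    distance v = least (λ k → withinDistance? k v) (walk⇒WithinDistance (connected v r))

    closer-neighbour : ∀ {v} k → Least (λ k → WithinDistance k v) k → v ≢ r →
                       Σ (Fin n) λ w → Adj G v w × k ≡ suc (proj₁ (distance w))
    closer-neighbour zero    (v≡r , _)      v≢r = contradiction v≡r v≢r
    closer-neighbour (suc k) (inj₁ v≡r , _) v≢r = contradiction v≡r v≢r
    closer-neighbour (suc k) (inj₂ (w , vw , w≤k) , below) _ =
      w , vw , cong suc (≤-antisym (≮⇒≥ λ dw<k → below _ (s≤s dw<k) (inj₂ (w , vw , proj₁ dw)))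
                                   (Least⇒≤ dw w≤k))
      where
      dw : Least (λ k → WithinDistance k w) (proj₁ (distance w))
      dw = proj₂ (distance w)

    bfs-layering : Layering ⊤
    bfs-layering = record
      { root   = r
      ; level  = proj₁ ∘ distance
      ; parent = λ {v} _ v≢r →
          let (w , vw , dv≡1+dw) = closer-neighbour _ (proj₂ (distance v)) v≢r
          in w , ∈⊤ , vw , dv≡1+dw
      }

  connected⇒partition : Connected G → HasTwoDistMVPartition G ⌈ n /2⌉
  connected⇒partition connected =
    let (c , good , bound) = pair-colouring n (∣⊤∣≡n n) (λ (r , _) → bfs-layering connected r)
    in colouring⇒partition (λ v → fromℕ< (bound ∈⊤))
                           (IsMVColouringOn-map toℕ (λ v → toℕ-fromℕ< (bound ∈⊤)) good)

  connected⇒χμ₂≤⌈n/2⌉ : Connected G → Σ ℕ λ k → χμ₂≡ G k × k ≤ ⌈ n /2⌉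
  connected⇒χμ₂≤⌈n/2⌉ connected =
    let partition = connected⇒partition connected
        (k , χμ₂≡k) = least hasTwoDistMVPartition? partition
    in k , χμ₂≡k , Least⇒≤ χμ₂≡k partition

module _ {n : ℕ} {G : Graph n} where

  _++_ : ∀ {u v w} → Walk G u v → Walk G v w → Walk G u w
  []       ++ q = q
  (uv ∷ p) ++ q = uv ∷ (p ++ q)

  reverse : ∀ {u v} → Walk G u v → Walk G v u
  reverse []       = []
  reverse (uv ∷ p) = reverse p ++ (Adj-sym G uv ∷ [])

-- Paths

consecutive : ℕ → ℕ → Bool
consecutive i j = (i ≡ᵇ suc j) ∨ (j ≡ᵇ suc i)

consecutive-irrefl : ∀ i → consecutive i i ≡ false
consecutive-irrefl zero    = refl
consecutive-irrefl (suc i) = consecutive-irrefl i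

Path : ∀ n → Graph n
Path n = record
  { adj    = λ u v → consecutive (toℕ u) (toℕ v)
  ; sym    = λ u v → ∨-comm (toℕ u ≡ᵇ suc (toℕ v)) _
  ; irrefl = λ v → consecutive-irrefl (toℕ v)
  }

Path-Adj⇒≤suc : ∀ {n} {u v : Fin n} → Adj (Path n) u v → toℕ v ≤ suc (toℕ u)
Path-Adj⇒≤suc {v = v} uv with Equivalence.to T-∨ (Equivalence.from T-≡ uv)
... | inj₁ u≡1+v = subst (λ i → toℕ v ≤ suc i) (sym (≡ᵇ⇒≡ _ _ u≡1+v)) (m≤n+m _ 2)
... | inj₂ v≡1+u = ≤-reflexive (≡ᵇ⇒≡ _ _ v≡1+u)

shift : ∀ {n} {u v : Fin n} → Walk (Path n) u v → Walk (Path (suc n)) (suc u) (suc v)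
shift []       = []
shift (uv ∷ q) = uv ∷ shift q

walk-from-zero : ∀ {n} (i : Fin (suc n)) → Walk (Path (suc n)) zero i
walk-from-zero zero            = []
walk-from-zero {suc _} (suc i) = refl ∷ shift (walk-from-zero i)

Path-connected : ∀ n → Connected (Path n)
Path-connected (suc n) u v = reverse (walk-from-zero u) ++ walk-from-zero v

n≤m*2⇒⌈n/2⌉≤m : ∀ {n} m → n ≤ m * 2 → ⌈ n /2⌉ ≤ m
n≤m*2⇒⌈n/2⌉≤m {zero}        _       _                 = z≤n
n≤m*2⇒⌈n/2⌉≤m {suc zero}    (suc m) _                 = s≤s z≤n
n≤m*2⇒⌈n/2⌉≤m {suc (suc n)} (suc m) (s≤s (s≤s n≤m*2)) = s≤s (n≤m*2⇒⌈n/2⌉≤m m n≤m*2)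

module _ {n k} (c : Fin n → Fin k) (good : IsMVColouringOn (Path n) ⊤ c) where

  no-monochromatic-triple : ∀ {x y z} → toℕ x < toℕ y → toℕ y < toℕ z → c x ≡ c y → c y ≡ c z → ⊥
  no-monochromatic-triple {x} {y} {z} x<y y<z cx≡cy cy≡cz
    with good x z ∈⊤ ∈⊤ x≢z (trans cx≡cy cy≡cz)
    where
    x≢z : x ≢ z
    x≢z x≡z = <-irrefl (cong toℕ x≡z) (<-trans x<y y<z)
  ... | inj₁ xz                    = <⇒≱ (≤-<-trans x<y y<z) (Path-Adj⇒≤suc xz)
  ... | inj₂ (w , xw , wz , cw≢cx) = cw≢cx (trans (cong c w≡y) (sym cx≡cy))
    where
    w≡y : w ≡ y
    w≡y = toℕ-injective (≤-antisym (≤-trans (Path-Adj⇒≤suc xw) x<y)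
                                   (≤-pred (≤-trans y<z (Path-Adj⇒≤suc wz))))

  EarlierTwin : Fin n → Set
  EarlierTwin y = Σ (Fin n) λ x → toℕ x < toℕ y × c x ≡ c y

  earlier-twin? : ∀ y → Dec (EarlierTwin y)
  earlier-twin? y = any? λ x → toℕ x <? toℕ y ×-dec c x ≟ᶠ c y

  twin-bit : Fin n → Fin 2
  twin-bit y with earlier-twin? y
  ... | yes _ = suc zero
  ... | no _  = zero

  twin-bit≡1⇔EarlierTwin : ∀ {y} → twin-bit y ≡ suc zero ⇔ EarlierTwin y
  twin-bit≡1⇔EarlierTwin {y} with earlier-twin? y
  ... | yes twin = mk⇔ (λ _ → twin) (λ _ → refl)
  ... | no ¬twin = mk⇔ (λ ()) (λ twin → contradiction twin ¬twin)

  -- A colour class of a path has at most two vertices, so a vertex is determined by its colour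
  -- and by whether an earlier vertex has the same colour.
  code : Fin n → Fin (k * 2)
  code y = combine (c y) (twin-bit y)

  code-separates : ∀ {x y} → toℕ x < toℕ y → c x ≡ c y → twin-bit x ≢ twin-bit y
  code-separates {x} x<y cx≡cy bx≡by
    with Equivalence.to twin-bit≡1⇔EarlierTwin
           (trans bx≡by (Equivalence.from twin-bit≡1⇔EarlierTwin (x , x<y , cx≡cy)))
  ... | w , w<x , cw≡cx = no-monochromatic-triple w<x x<y cw≡cx cx≡cy

  code-injective : Injective _≡_ _≡_ code
  code-injective {x} {y} eq with combine-injective (c x) (twin-bit x) (c y) (twin-bit y) eq
  ... | cx≡cy , bx≡by with <-cmp (toℕ x) (toℕ y)
  ...   | tri< x<y _ _ = contradiction bx≡by (code-separates x<y cx≡cy)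
  ...   | tri≈ _ x≡y _ = toℕ-injective x≡y
  ...   | tri> _ _ y<x = contradiction (sym bx≡by) (code-separates y<x (sym cx≡cy))

Path-partition⇒⌈n/2⌉≤ : ∀ {n k} → HasTwoDistMVPartition (Path n) k → ⌈ n /2⌉ ≤ k
Path-partition⇒⌈n/2⌉≤ {k = k} partition =
  let (c , good) = partition⇒colouring (Path _) partition in
  n≤m*2⇒⌈n/2⌉≤m k (injective⇒≤ (code-injective c good))

Path-χμ₂ : ∀ n → χμ₂≡ (Path n) ⌈ n /2⌉
Path-χμ₂ n = connected⇒partition (Path n) (Path-connected n) ,
             λ j j<⌈n/2⌉ partition → <⇒≱ j<⌈n/2⌉ (Path-partition⇒⌈n/2⌉≤ partition)

theorem3p1 : ((n : ℕ) (G : Graph n) → Connected G →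
    Σ ℕ λ k → χμ₂≡ G k × k ≤ ⌈ n /2⌉)
    ×
    ((N : ℕ) → Σ ℕ λ n → N ≤ n × Σ (Graph n) λ G →
    Connected G × χμ₂≡ G ⌈ n /2⌉)
theorem3p1 = (λ _ → connected⇒χμ₂≤⌈n/2⌉) ,
             λ N → N , ≤-refl , Path N , Path-connected N , Path-χμ₂ N
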